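{- Let $|V|=n$, $N=\binom n2$, and let $e_1,\dots,e_N$ be a sequence of edges on $V$ such that each $G_i=(V,\{e_1,\dots,e_i\})$ is acyclic; for each $i$ let $T_{i-1}$ be a topological order of $G_{i-1}$. Then $\sum_{i=1}^N|\delta^{(i)}|\le n(n-1)=O(n^2)$.
   Context: $x\leadsto y$ means there is a directed path from $x$ to $y$ in the current graph (with $x\leadsto x$). A topological order is a bijection $T:V\to\{1,\dots,n\}$ with $T(x)<T(y)$ whenever $x\leadsto y$, $x\ne y$. For the $i$-th edge $e_i=u\to v$ and $T=T_{i-1}$, $\delta^{(i)}=\{y: T(y)\le T(u),\ v\leadsto y\}\cup\{x: T(v)\le T(x),\ x\leadsto u\}$ and $|\delta^{(i)}|$ is its number of nodes. -}

module Defs where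

open import Data.Nat using (ℕ; _<_)
open import Data.Fin using (Fin; toℕ) renaming (_≤_ to _≤ᶠ_)
open import Data.Product using (_×_; ∃)
open import Data.Sum using (_⊎_)
open import Relation.Nullary using (¬_)
open import Relation.Binary.PropositionalEquality using (_≡_)
open import Function.Definitions using (Bijective)

Edge : ℕ → Set
Edge n = Fin n × Fin n

EdgeSet : ℕ → Set₁
EdgeSet n = Edge n → Set

data Reach {n : ℕ} (E : EdgeSet n) : Fin n → Fin n → Set where
  here : ∀ {x} → Reach E x x
  step : ∀ {x y z} → E (x Data.Product., y) → Reach E y z → Reach E x z

-- Acyclic: no directed cycle, i.e. no edge u → v with v ⇝ u
-- (this also excludes self-loops).
Acyclic : ∀ {n} → EdgeSet n → Set
Acyclic E = ∀ u v → E (u Data.Product., v) → ¬ Reach E v u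

-- Topological order: a bijection T : V → {1..n} (here Fin n ≅ {0..n-1})
-- with T x < T y whenever x ⇝ y and x ≠ y.
IsTopOrder : ∀ {n} → EdgeSet n → (Fin n → Fin n) → Set
IsTopOrder E T = Bijective _≡_ _≡_ T ×
  (∀ x y → Reach E x y → ¬ (x ≡ y) → toℕ (T x) < toℕ (T y))

-- G_i = (V, {e_1,…,e_i}) where the sequence is es : Fin N → Edge n
-- (es j is the edge e_{j+1}).
Prefix : ∀ {n N} → (Fin N → Edge n) → ℕ → EdgeSet n
Prefix es i e = ∃ λ j → toℕ j < i × es j ≡ e

-- Membership in δ^(i) for the edge e_i = u → v, order T = T_{i-1},
-- graph E = G_{i-1}.
InDelta : ∀ {n} → EdgeSet n → (Fin n → Fin n) → Edge n → Fin n → Set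
InDelta E T (u Data.Product., v) x =
  (T x ≤ᶠ T u × Reach E v x) ⊎ (T v ≤ᶠ T x × Reach E x u)

-- Charge each x ∈ δ⁽ⁱ⁾ to an ordered pair of distinct vertices: to (uᵢ , x) if x lies in the
-- forward part (vᵢ ⇝ x) and to (vᵢ , x) if it lies in the backward part (x ⇝ uᵢ).  Distinct
-- indices i < i' never produce the same pair: for two forward charges uᵢ = uᵢ' the path
-- uᵢ → vᵢ ⇝ x of G_{i'-1} forces T_{i'-1}(uᵢ') < T_{i'-1}(x), contradicting membership in δ⁽ⁱ'⁾
-- (dually for two backward charges), and a forward and a backward charge with uᵢ = vᵢ' would
-- close the cycle uᵢ ⇝ x ⇝ uᵢ in the acyclic final graph.  So the charges are injective, and
-- there are only n(n-1) ordered pairs of distinct vertices.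
module Submission where

open import Defs
open import Data.Nat using (ℕ; suc; _+_; _≤_; _<_; _*_; _∸_)
open import Data.Nat.Properties using (≤-refl; <⇒≤; <-≤-trans; <⇒≱; <-cmp)
open import Data.Nat.Combinatorics using (_C_)
open import Data.Fin using (Fin; toℕ; combine; punchOut)
open import Data.Fin.Properties using (toℕ<n; toℕ-injective; combine-injective; punchOut-injective; injective⇒≤)
open import Data.List using (List; []; _∷_; _++_; length; map; concatMap; lookup; allFin)
open import Data.List.Properties using (length-++; length-map)
open import Data.Nat.ListAction using (sum)
open import Data.List.Membership.Propositional using (_∈_)
open import Data.List.Membership.Propositional.Properties using (∈-lookup; ∈-++⁻; ∈-map⁻)
open import Data.List.Relation.Unary.Any using (here; there)
import Data.List.Relation.Unary.All as All
open import Data.List.Relation.Unary.AllPairs using ([]; _∷_)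
open import Data.List.Relation.Unary.Unique.Propositional using (Unique)
open import Data.List.Relation.Unary.Unique.Propositional.Properties using (map⁺; ++⁺; allFin⁺)
open import Data.Product using (_×_; _,_; proj₁; proj₂; map₁)
open import Data.Sum using (inj₁; inj₂)
open import Function using (_∘_)
open import Function.Bundles using (_⇔_; Equivalence)
open import Function.Definitions using (Injective)
open import Relation.Binary using (tri<; tri≈; tri>)
open import Relation.Binary.PropositionalEquality using (_≡_; _≢_; refl; sym; cong; cong₂; subst; module ≡-Reasoning)
open import Relation.Nullary using (¬_; contradiction)

module _ {A : Set} where

  lookup-injective : ∀ {xs : List A} → Unique xs → Injective _≡_ _≡_ (lookup xs)
  lookup-injective {_ ∷ _}  _        {Fin.zero}  {Fin.zero}  _  = refl
  lookup-injective {_ ∷ xs} (x∉ ∷ _) {Fin.zero}  {Fin.suc j} eq = contradiction eq (All.lookup x∉ (∈-lookup {xs = xs} j))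
  lookup-injective {_ ∷ xs} (x∉ ∷ _) {Fin.suc i} {Fin.zero}  eq = contradiction (sym eq) (All.lookup x∉ (∈-lookup {xs = xs} i))
  lookup-injective {_ ∷ _}  (_ ∷ u)  {Fin.suc i} {Fin.suc j} eq = cong Fin.suc (lookup-injective u eq)

  unique-length≤ : ∀ {k} {xs : List A} → Unique xs
    → (f : ∀ {x} → x ∈ xs → Fin k)
    → (∀ {x y} (p : x ∈ xs) (q : y ∈ xs) → f p ≡ f q → x ≡ y)
    → length xs ≤ k
  unique-length≤ u f f-inj = injective⇒≤ (lookup-injective u ∘ f-inj (∈-lookup _) (∈-lookup _))

module _ {I A : Set} (δ : I → List A) where

  tagged : List I → List (I × A)
  tagged = concatMap (λ i → map (i ,_) (δ i))

  length-tagged : ∀ is → length (tagged is) ≡ sum (map (λ i → length (δ i)) is)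
  length-tagged []       = refl
  length-tagged (i ∷ is) = begin
    length (map (i ,_) (δ i) ++ tagged is)           ≡⟨ length-++ (map (i ,_) (δ i)) ⟩
    length (map (i ,_) (δ i)) + length (tagged is)   ≡⟨ cong₂ _+_ (length-map (i ,_) (δ i)) (length-tagged is) ⟩
    length (δ i) + sum (map (λ i → length (δ i)) is) ∎
    where open ≡-Reasoning

  ∈-tagged⁻ : ∀ is {i x} → (i , x) ∈ tagged is → i ∈ is × x ∈ δ i
  ∈-tagged⁻ (j ∷ is) m with ∈-++⁻ (map (j ,_) (δ j)) m
  ... | inj₂ m′ = map₁ there (∈-tagged⁻ is m′)
  ... | inj₁ m′ with ∈-map⁻ (j ,_) m′
  ...   | _ , x∈ , refl = here refl , x∈

  tagged-unique : ∀ {is} → Unique is → (∀ i → Unique (δ i)) → Unique (tagged is)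
  tagged-unique {[]}     _         _  = []
  tagged-unique {j ∷ is} (j∉ ∷ u) uδ =
    ++⁺ (map⁺ (cong proj₂) (uδ j)) (tagged-unique u uδ) disjoint
    where
    disjoint : ∀ {p} → ¬ (p ∈ map (j ,_) (δ j) × p ∈ tagged is)
    disjoint (m , m′) with ∈-map⁻ (j ,_) m
    ... | _ , _ , refl = All.lookup j∉ (proj₁ (∈-tagged⁻ is m′)) refl

encode≢ : ∀ {n} {a b : Fin n} → a ≢ b → Fin (n * (n ∸ 1))
encode≢ {suc _} {a} a≢b = combine a (punchOut a≢b)

encode≢-injective : ∀ {n} {a b c d : Fin n} (p : a ≢ b) (q : c ≢ d) → encode≢ p ≡ encode≢ q → a ≡ c × b ≡ d
encode≢-injective {suc _} {a} {_} {c} p q eq with combine-injective a _ c _ eq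
... | refl , eq′ = refl , punchOut-injective p q eq′

module _ {n : ℕ} where

  reach-trans : ∀ {E : EdgeSet n} {a b c} → Reach E a b → Reach E b c → Reach E a c
  reach-trans here       r′ = r′
  reach-trans (step e r) r′ = step e (reach-trans r r′)

  reach-mono : ∀ {E E′ : EdgeSet n} → (∀ {e} → E e → E′ e) → ∀ {a b} → Reach E a b → Reach E′ a b
  reach-mono E⊆E′ here       = here
  reach-mono E⊆E′ (step e r) = step (E⊆E′ e) (reach-mono E⊆E′ r)

  acyclic⇒reach-antisym : ∀ {E : EdgeSet n} → Acyclic E → ∀ {a b} → Reach E a b → Reach E b a → a ≡ b
  acyclic⇒reach-antisym ac here       _  = refl
  acyclic⇒reach-antisym ac (step e r) r′ = contradiction (reach-trans r r′) (ac _ _ e)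

prefix-mono : ∀ {n N} (es : Fin N → Edge n) {i k} → i ≤ k → ∀ {e} → Prefix es i e → Prefix es k e
prefix-mono es i≤k (j , j<i , refl) = j , <-≤-trans j<i i≤k , refl

module Charging {n N : ℕ} (es : Fin N → Edge n)
  (acyclic : Acyclic (Prefix es N))
  (Ts : Fin N → Fin n → Fin n)
  (topological : ∀ j → IsTopOrder (Prefix es (toℕ j)) (Ts j)) where

  G : ℕ → EdgeSet n
  G = Prefix es

  src tgt : Fin N → Fin n
  src j = proj₁ (es j)
  tgt j = proj₂ (es j)

  Δ : Fin N → Fin n → Set
  Δ j = InDelta (G (toℕ j)) (Ts j) (es j)

  charge : ∀ {j x} → Δ j x → Fin n
  charge {j} (inj₁ _) = src j
  charge {j} (inj₂ _) = tgt j

  ordered : ∀ (j : Fin N) {x y} → Reach (G (toℕ j)) x y → x ≢ y → toℕ (Ts j x) < toℕ (Ts j y)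
  ordered j = proj₂ (topological j) _ _

  reach-later : ∀ (j : Fin N) {k a b} → toℕ j ≤ k → Reach (G (toℕ j)) a b → Reach (G k) a b
  reach-later j j≤k = reach-mono (prefix-mono es j≤k)

  forward-reach : ∀ (j : Fin N) {k x} → toℕ j < k → Reach (G (toℕ j)) (tgt j) x → Reach (G k) (src j) x
  forward-reach j j<k r = step (j , j<k , refl) (reach-later j (<⇒≤ j<k) r)

  backward-reach : ∀ (j : Fin N) {k x} → toℕ j < k → Reach (G (toℕ j)) x (src j) → Reach (G k) x (tgt j)
  backward-reach j j<k r = reach-trans (reach-later j (<⇒≤ j<k) r) (step (j , j<k , refl) here)

  ¬tgt⇝src : ∀ (j : Fin N) → ¬ Reach (G (toℕ j)) (tgt j) (src j)
  ¬tgt⇝src j r = acyclic _ _ (j , toℕ<n j , refl) (reach-later j (<⇒≤ (toℕ<n j)) r)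

  src≢ : ∀ (j : Fin N) {x} → Reach (G (toℕ j)) (tgt j) x → src j ≢ x
  src≢ j r refl = ¬tgt⇝src j r

  ≢tgt : ∀ (j : Fin N) {x} → Reach (G (toℕ j)) x (src j) → x ≢ tgt j
  ≢tgt j r refl = ¬tgt⇝src j r

  charge≢ : ∀ {j x} (d : Δ j x) → charge d ≢ x
  charge≢ {j} (inj₁ (_ , r)) = src≢ j r
  charge≢ {j} (inj₂ (_ , r)) = ≢tgt j r ∘ sym

  src≢tgt : ∀ (j j′ : Fin N) {x} → Reach (G (toℕ j)) (tgt j) x → Reach (G (toℕ j′)) x (src j′) → src j ≢ tgt j′
  src≢tgt j j′ r r′ eq = src≢ j r (acyclic⇒reach-antisym acyclic
    (forward-reach j (toℕ<n j) r)
    (subst (Reach (G N) _) (sym eq) (backward-reach j′ (toℕ<n j′) r′)))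

  charge-earlier≢ : ∀ {j j′ x} → toℕ j < toℕ j′ → (d : Δ j x) (d′ : Δ j′ x) → charge d ≢ charge d′
  charge-earlier≢ {j} {j′} j<j′ (inj₁ (_ , r)) (inj₁ (x≤src′ , _)) eq =
    <⇒≱ (ordered j′ (forward-reach j j<j′ r) (src≢ j r))
        (subst (λ w → toℕ (Ts j′ _) ≤ toℕ (Ts j′ w)) (sym eq) x≤src′)
  charge-earlier≢ {j} {j′} j<j′ (inj₂ (_ , r)) (inj₂ (tgt′≤x , _)) eq =
    <⇒≱ (ordered j′ (backward-reach j j<j′ r) (≢tgt j r))
        (subst (λ w → toℕ (Ts j′ w) ≤ toℕ (Ts j′ _)) (sym eq) tgt′≤x)
  charge-earlier≢ {j} {j′} _ (inj₁ (_ , r)) (inj₂ (_ , r′)) = src≢tgt j j′ r r′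
  charge-earlier≢ {j} {j′} _ (inj₂ (_ , r)) (inj₁ (_ , r′)) = src≢tgt j′ j r′ r ∘ sym

  charge-injective : ∀ {j j′ x} (d : Δ j x) (d′ : Δ j′ x) → charge d ≡ charge d′ → j ≡ j′
  charge-injective {j} {j′} d d′ eq with <-cmp (toℕ j) (toℕ j′)
  ... | tri< j<j′ _ _ = contradiction eq (charge-earlier≢ j<j′ d d′)
  ... | tri≈ _ j≡j′ _ = toℕ-injective j≡j′
  ... | tri> _ _ j′<j = contradiction (sym eq) (charge-earlier≢ j′<j d′ d)

  sum-length-δ≤ : (δ : Fin N → List (Fin n)) → (∀ j → Unique (δ j)) → (∀ j {x} → x ∈ δ j → Δ j x)
    → sum (map (λ j → length (δ j)) (allFin N)) ≤ n * (n ∸ 1)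
  sum-length-δ≤ δ unique sound = subst (_≤ n * (n ∸ 1)) (length-tagged δ (allFin N))
    (unique-length≤ (tagged-unique δ (allFin⁺ N) unique) label label-injective)
    where
    Δ-of : ∀ {j x} → (j , x) ∈ tagged δ (allFin N) → Δ j x
    Δ-of {j} m = sound j (proj₂ (∈-tagged⁻ δ (allFin N) m))

    label : ∀ {p} → p ∈ tagged δ (allFin N) → Fin (n * (n ∸ 1))
    label m = encode≢ (charge≢ (Δ-of m))

    label-injective : ∀ {p q} (m : p ∈ tagged δ (allFin N)) (m′ : q ∈ tagged δ (allFin N)) → label m ≡ label m′ → p ≡ q
    label-injective m m′ eq with encode≢-injective (charge≢ (Δ-of m)) (charge≢ (Δ-of m′)) eq
    ... | same-charge , refl = cong₂ _,_ (charge-injective (Δ-of m) (Δ-of m′) same-charge) refl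

theorem4 : (n : ℕ) (es : Fin (n C 2) → Edge n)
    → (∀ (i : ℕ) → i ≤ n C 2 → Acyclic (Prefix es i))
    → (Ts : Fin (n C 2) → Fin n → Fin n)
    → (∀ (j : Fin (n C 2)) → IsTopOrder (Prefix es (toℕ j)) (Ts j))
    → (δ : Fin (n C 2) → List (Fin n))
    → (∀ (j : Fin (n C 2)) → Unique (δ j)
    × (∀ x → (x ∈ δ j) ⇔ InDelta (Prefix es (toℕ j)) (Ts j) (es j) x))
    → sum (map (λ j → length (δ j)) (allFin (n C 2))) ≤ n * (n ∸ 1)
theorem4 n es acyclic Ts topological δ δ-spec =
  Charging.sum-length-δ≤ es (acyclic (n C 2) ≤-refl) Ts topological δ
    (proj₁ ∘ δ-spec) (λ j → Equivalence.to (proj₂ (δ-spec j) _))
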